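{- Let $G=(V,E)$ be a graph with $n$ vertices. Then $$\mathrm{ID}(G,x)=\sum_{k=0}^{n}x^k\sum_{\substack{W\subseteq V\\ \mathrm{iso}(G[W])\ge k}}(-1)^{|W|+k}\binom{\mathrm{iso}(G[W])}{k}.$$
   Context: All graphs are finite, simple and undirected. $\mathrm{iso}(H)$ is the number of isolated vertices of a graph $H$. $G[W]$ is the subgraph induced by $W$, and $\mathrm{iso}(G[\emptyset])=0$. A set $W\subseteq V$ is an independent dominating set of $G=(V,E)$ if every vertex of $V\setminus W$ is adjacent to at least one vertex of $W$ and no two vertices of $W$ are adjacent. The independent domination polynomial is $\mathrm{ID}(G,x)=\sum_{W}x^{|W|}$, the sum over all independent dominating sets $W$ of $G$. -}

module Defs where

open import Data.Bool using (Bool; true; false; _∧_; _∨_; not; if_then_else_)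
open import Data.Nat using (ℕ; zero; suc; _≤ᵇ_)
open import Data.Nat.Combinatorics using (_C_)
open import Data.Integer using (ℤ; +_; -_; _+_; _*_; _^_)
open import Data.Fin using (Fin)
open import Data.Fin.Subset using (Subset; inside; outside; ∣_∣)
open import Data.Vec using (Vec; []; _∷_; lookup)
open import Data.List using (List; []; _∷_; map; _++_; foldr; allFin)
open import Data.Bool.ListAction using (all; any)
open import Relation.Binary.PropositionalEquality using (_≡_)

record Graph (n : ℕ) : Set where
  field
    adj    : Fin n → Fin n → Bool
    symm   : ∀ u v → adj u v ≡ adj v u
    irrefl : ∀ v → adj v v ≡ false
open Graph public

_∈ᵇ_ : ∀ {n} → Fin n → Subset n → Bool
v ∈ᵇ W = lookup W v

allSubsets : ∀ n → List (Subset n)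
allSubsets zero    = [] ∷ []
allSubsets (suc n) = map (outside ∷_) (allSubsets n) ++ map (inside ∷_) (allSubsets n)

sumℤ : List ℤ → ℤ
sumℤ = foldr _+_ (+ 0)

isIndependent : ∀ {n} → Graph n → Subset n → Bool
isIndependent G W =
  all (λ u → all (λ v → not (u ∈ᵇ W ∧ v ∈ᵇ W ∧ adj G u v)) (allFin _)) (allFin _)

isDominating : ∀ {n} → Graph n → Subset n → Bool
isDominating G W =
  all (λ v → v ∈ᵇ W ∨ any (λ u → u ∈ᵇ W ∧ adj G u v) (allFin _)) (allFin _)

isIndepDominating : ∀ {n} → Graph n → Subset n → Bool
isIndepDominating G W = isIndependent G W ∧ isDominating G W

countᵇ : {A : Set} → (A → Bool) → List A → ℕ
countᵇ p = foldr (λ a c → if p a then suc c else c) 0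

iso : ∀ {n} → Graph n → Subset n → ℕ
iso G W = countᵇ (λ v → v ∈ᵇ W ∧ not (any (λ u → u ∈ᵇ W ∧ adj G u v) (allFin _))) (allFin _)

-- Polynomials with integer coefficients, represented by their coefficient
-- sequences: p k is the coefficient of x^k.
Poly : Set
Poly = ℕ → ℤ

_⊕_ : Poly → Poly → Poly
(p ⊕ q) k = p k + q k

zeroP : Poly
zeroP _ = + 0

monomial : ℤ → ℕ → Poly
monomial c k j = if (k ≤ᵇ j) ∧ (j ≤ᵇ k) then c else + 0

sumP : ℕ → (ℕ → Poly) → Poly
sumP zero    f = f zero
sumP (suc n) f = sumP n f ⊕ f (suc n)

ID : ∀ {n} → Graph n → Poly
ID {n} G = foldr (λ W p → if isIndepDominating G W then monomial (+ 1) ∣ W ∣ ⊕ p else p)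
                 zeroP (allSubsets n)

innerSum : ∀ {n} → Graph n → ℕ → ℤ
innerSum {n} G k =
  sumℤ (map (λ W → if k ≤ᵇ iso G W
                    then ((- (+ 1)) ^ (∣ W ∣ Data.Nat.+ k)) * (+ (iso G W C k))
                    else + 0)
            (allSubsets n))

module Submission where

-- Write ⟦ b ⟧ for the 0/1 indicator of a Boolean b and Iso(W) for the set of
-- isolated vertices of G[W].  The heart of the proof is, for every I ⊆ V,
--
--   (*)  Σ_{W ⊆ V} (-1)^|W| ⟦ I ⊆ Iso(W) ⟧ = (-1)^|I| ⟦ I is independent dominating ⟧.
--
-- Both "I ⊆ Iso(W)" and "I is independent dominating" are conjunctions of
-- conditions on single vertices u, each involving only [u ∈ I], [u has a
-- neighbour in I] and (for the first) [u ∈ W].  Hence the sum over W factors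
-- as a product over u of two-term sums, each settled by a four-case check.
-- Substituting (*) into the coefficient Σ_{|I| = j} ⟦ I is IDS ⟧ of x^j in
-- ID(G,x), exchanging the sums over I and W, and counting the j-subsets of
-- Iso(W) gives Σ_W (-1)^{|W|+j} C(iso(G[W]), j), the j-th inner sum.  The
-- right-hand polynomial has exactly these coefficients in degrees ≤ n, and
-- both sides vanish above degree n.

open import Defs
open import Algebra.Bundles using (CommutativeMonoid)
open import Data.Bool using (Bool; true; false; _∧_; _∨_; not; if_then_else_; T)
open import Data.Bool.Properties
  using (∨-zeroʳ; ∨-distribˡ-∧; ∧-commutativeMonoid; ∨-∧-booleanAlgebra; T-≡)
open import Algebra.Lattice.Properties.BooleanAlgebra ∨-∧-booleanAlgebra using (deMorgan₁)
open import Algebra.Properties.CommutativeSemigroup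
  (CommutativeMonoid.commutativeSemigroup ∧-commutativeMonoid) using (interchange)
open import Data.Bool.ListAction using (all; any)
open import Data.Nat as ℕ using (ℕ; zero; suc; _≤ᵇ_; _<ᵇ_; _≡ᵇ_; _≤_; _<_; z≤n; s≤s)
import Data.Nat.Properties as ℕP
open import Data.Nat.Combinatorics using (_C_; k>n⇒nCk≡0; nCk+nC[k+1]≡[n+1]C[k+1])
open import Data.Integer using (ℤ; +_; -_; _+_; _*_; _^_)
open import Data.Integer.Properties
  using (+-identityˡ; +-identityʳ; +-assoc; *-identityˡ; *-zeroˡ; *-zeroʳ;
         *-distribˡ-+; *-distribʳ-+; *-assoc; ^-distribˡ-+-*)
open import Data.Integer.Tactic.RingSolver using (solve-∀)
open import Data.Fin using (Fin; zero; suc)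
open import Data.Fin.Subset using (Subset; inside; outside; ∣_∣)
open import Data.Vec using ([]; _∷_; lookup)
open import Data.List using (List; []; _∷_; map; _++_; foldr; allFin; tabulate)
import Data.List.Properties as LP
open import Data.Sum using (inj₁; inj₂)
open import Data.Empty using (⊥-elim)
open import Relation.Nullary using (¬_)
open import Function using (id; _∘_; Equivalence)
open import Relation.Binary.PropositionalEquality
open ≡-Reasoning

⟦_⟧ : Bool → ℤ
⟦ true ⟧  = + 1
⟦ false ⟧ = + 0

⟦∧⟧ : ∀ a b → ⟦ a ∧ b ⟧ ≡ ⟦ a ⟧ * ⟦ b ⟧
⟦∧⟧ true  b = sym (*-identityˡ ⟦ b ⟧)
⟦∧⟧ false b = refl

allF : ∀ n → (Fin n → Bool) → Bool
allF zero    p = true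
allF (suc n) p = p zero ∧ allF n (p ∘ suc)

anyF : ∀ n → (Fin n → Bool) → Bool
anyF zero    p = false
anyF (suc n) p = p zero ∨ anyF n (p ∘ suc)

countF : ∀ n → (Fin n → Bool) → ℕ
countF zero    p = 0
countF (suc n) p = if p zero then suc (countF n (p ∘ suc)) else countF n (p ∘ suc)

prodF : ∀ n → (Fin n → ℤ) → ℤ
prodF zero    f = + 1
prodF (suc n) f = f zero * prodF n (f ∘ suc)

all-tabulate : ∀ {A : Set} n (p : A → Bool) (f : Fin n → A) →
               all p (tabulate f) ≡ allF n (p ∘ f)
all-tabulate zero    p f = refl
all-tabulate (suc n) p f = cong (p (f zero) ∧_) (all-tabulate n p (f ∘ suc))

any-tabulate : ∀ {A : Set} n (p : A → Bool) (f : Fin n → A) →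
               any p (tabulate f) ≡ anyF n (p ∘ f)
any-tabulate zero    p f = refl
any-tabulate (suc n) p f = cong (p (f zero) ∨_) (any-tabulate n p (f ∘ suc))

count-tabulate : ∀ {A : Set} n (p : A → Bool) (f : Fin n → A) →
                 countᵇ p (tabulate f) ≡ countF n (p ∘ f)
count-tabulate zero    p f = refl
count-tabulate (suc n) p f =
  cong (λ c → if p (f zero) then suc c else c) (count-tabulate n p (f ∘ suc))

allF-cong : ∀ n {p q : Fin n → Bool} → (∀ i → p i ≡ q i) → allF n p ≡ allF n q
allF-cong zero    e = refl
allF-cong (suc n) e = cong₂ _∧_ (e zero) (allF-cong n (e ∘ suc))

anyF-cong : ∀ n {p q : Fin n → Bool} → (∀ i → p i ≡ q i) → anyF n p ≡ anyF n q
anyF-cong zero    e = refl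
anyF-cong (suc n) e = cong₂ _∨_ (e zero) (anyF-cong n (e ∘ suc))

countF-cong : ∀ n {p q : Fin n → Bool} → (∀ i → p i ≡ q i) → countF n p ≡ countF n q
countF-cong zero    e = refl
countF-cong (suc n) {p} {q} e rewrite e zero = cong (λ c → if q zero then suc c else c)
                                                    (countF-cong n (e ∘ suc))

prodF-cong : ∀ n {f g : Fin n → ℤ} → (∀ i → f i ≡ g i) → prodF n f ≡ prodF n g
prodF-cong zero    e = refl
prodF-cong (suc n) e = cong₂ _*_ (e zero) (prodF-cong n (e ∘ suc))

countF≤ : ∀ n (p : Fin n → Bool) → countF n p ≤ n
countF≤ zero    p = z≤n
countF≤ (suc n) p with p zero
... | true  = s≤s (countF≤ n (p ∘ suc))
... | false = ℕP.m≤n⇒m≤1+n (countF≤ n (p ∘ suc))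

allF-true : ∀ n → allF n (λ _ → true) ≡ true
allF-true zero    = refl
allF-true (suc n) = allF-true n

allF-∧ : ∀ n (p q : Fin n → Bool) →
         allF n (λ i → p i ∧ q i) ≡ allF n p ∧ allF n q
allF-∧ zero    p q = refl
allF-∧ (suc n) p q = trans (cong ((p zero ∧ q zero) ∧_) (allF-∧ n (p ∘ suc) (q ∘ suc)))
                           (interchange (p zero) (q zero) _ _)

∨-allF : ∀ n b (p : Fin n → Bool) → b ∨ allF n p ≡ allF n (λ i → b ∨ p i)
∨-allF zero    b p = ∨-zeroʳ b
∨-allF (suc n) b p = trans (∨-distribˡ-∧ b (p zero) _)
                           (cong ((b ∨ p zero) ∧_) (∨-allF n b (p ∘ suc)))

not-anyF : ∀ n (p : Fin n → Bool) → not (anyF n p) ≡ allF n (λ i → not (p i))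
not-anyF zero    p = refl
not-anyF (suc n) p with p zero
... | true  = refl
... | false = not-anyF n (p ∘ suc)

∨-not-anyF : ∀ n b (p : Fin n → Bool) →
             b ∨ not (anyF n p) ≡ allF n (λ i → b ∨ not (p i))
∨-not-anyF n b p = trans (cong (b ∨_) (not-anyF n p)) (∨-allF n b _)

allF-swap : ∀ m n (f : Fin m → Fin n → Bool) →
            allF m (λ i → allF n (f i)) ≡ allF n (λ j → allF m (λ i → f i j))
allF-swap zero    n f = sym (allF-true n)
allF-swap (suc m) n f =
  trans (cong (allF n (f zero) ∧_) (allF-swap m n (f ∘ suc)))
        (sym (allF-∧ n (f zero) (λ j → allF m (λ i → f (suc i) j))))

⟦allF⟧ : ∀ n (p : Fin n → Bool) → ⟦ allF n p ⟧ ≡ prodF n (λ i → ⟦ p i ⟧)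
⟦allF⟧ zero    p = refl
⟦allF⟧ (suc n) p = trans (⟦∧⟧ (p zero) _) (cong (⟦ p zero ⟧ *_) (⟦allF⟧ n (p ∘ suc)))

prodF-* : ∀ n (f g : Fin n → ℤ) → prodF n f * prodF n g ≡ prodF n (λ i → f i * g i)
prodF-* zero    f g = refl
prodF-* (suc n) f g = trans (interchange* (f zero) (g zero) _ _)
                            (cong (f zero * g zero *_) (prodF-* n (f ∘ suc) (g ∘ suc)))
  where
  interchange* : ∀ a b c d → a * c * (b * d) ≡ a * b * (c * d)
  interchange* = solve-∀

sumℤ-++ : ∀ (xs ys : List ℤ) → sumℤ (xs ++ ys) ≡ sumℤ xs + sumℤ ys
sumℤ-++ []       ys = sym (+-identityˡ _)
sumℤ-++ (x ∷ xs) ys = trans (cong (_+_ x) (sumℤ-++ xs ys)) (sym (+-assoc x _ _))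

module _ {A : Set} where

  sum-cong : ∀ (xs : List A) {f g : A → ℤ} → (∀ x → f x ≡ g x) →
             sumℤ (map f xs) ≡ sumℤ (map g xs)
  sum-cong xs e = cong sumℤ (LP.map-cong e xs)

  sum-zero : ∀ (xs : List A) {f : A → ℤ} → (∀ x → f x ≡ + 0) → sumℤ (map f xs) ≡ + 0
  sum-zero []       e = refl
  sum-zero (x ∷ xs) e = cong₂ _+_ (e x) (sum-zero xs e)

  sum-+ : ∀ (xs : List A) (f g : A → ℤ) →
          sumℤ (map (λ x → f x + g x) xs) ≡ sumℤ (map f xs) + sumℤ (map g xs)
  sum-+ []       f g = refl
  sum-+ (x ∷ xs) f g = trans (cong (_+_ (f x + g x)) (sum-+ xs f g)) (interchange+ (f x) (g x) _ _)
    where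
    interchange+ : ∀ a b c d → a + b + (c + d) ≡ a + c + (b + d)
    interchange+ = solve-∀

  sum-* : ∀ (xs : List A) (c : ℤ) (f : A → ℤ) →
          sumℤ (map (λ x → c * f x) xs) ≡ c * sumℤ (map f xs)
  sum-* []       c f = sym (*-zeroʳ c)
  sum-* (x ∷ xs) c f = trans (cong (_+_ (c * f x)) (sum-* xs c f)) (sym (*-distribˡ-+ c (f x) _))

sum-swap : ∀ {A B : Set} (xs : List A) (ys : List B) (f : A → B → ℤ) →
           sumℤ (map (λ x → sumℤ (map (f x) ys)) xs)
           ≡ sumℤ (map (λ y → sumℤ (map (λ x → f x y) xs)) ys)
sum-swap []       ys f = sym (sum-zero ys (λ _ → refl))
sum-swap (x ∷ xs) ys f =
  trans (cong (_+_ (sumℤ (map (f x) ys))) (sum-swap xs ys f))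
        (sym (sum-+ ys (f x) (λ y → sumℤ (map (λ x′ → f x′ y) xs))))

ΣS : ∀ n → (Subset n → ℤ) → ℤ
ΣS n f = sumℤ (map f (allSubsets n))

ΣS-suc : ∀ n (f : Subset (suc n) → ℤ) →
         ΣS (suc n) f ≡ ΣS n (f ∘ (outside ∷_)) + ΣS n (f ∘ (inside ∷_))
ΣS-suc n f = begin
    sumℤ (map f (map (outside ∷_) S ++ map (inside ∷_) S))
  ≡⟨ cong sumℤ (LP.map-++ f (map (outside ∷_) S) _) ⟩
    sumℤ (map f (map (outside ∷_) S) ++ map f (map (inside ∷_) S))
  ≡⟨ sumℤ-++ (map f (map (outside ∷_) S)) _ ⟩
    sumℤ (map f (map (outside ∷_) S)) + sumℤ (map f (map (inside ∷_) S))
  ≡⟨ sym (cong₂ _+_ (cong sumℤ (LP.map-∘ S)) (cong sumℤ (LP.map-∘ S))) ⟩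
    ΣS n (f ∘ (outside ∷_)) + ΣS n (f ∘ (inside ∷_))
  ∎
  where
  S = allSubsets n

ΣS-∏ : ∀ n (g : Fin n → Bool → ℤ) →
       ΣS n (λ W → prodF n (λ i → g i (lookup W i))) ≡ prodF n (λ i → g i false + g i true)
ΣS-∏ zero    g = refl
ΣS-∏ (suc n) g = begin
    ΣS (suc n) (λ W → prodF (suc n) (λ i → g i (lookup W i)))
  ≡⟨ ΣS-suc n _ ⟩
    ΣS n (λ W → g zero false * P W) + ΣS n (λ W → g zero true * P W)
  ≡⟨ cong₂ _+_ (sum-* (allSubsets n) (g zero false) P) (sum-* (allSubsets n) (g zero true) P) ⟩
    g zero false * ΣS n P + g zero true * ΣS n P
  ≡⟨ sym (*-distribʳ-+ (ΣS n P) (g zero false) (g zero true)) ⟩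
    (g zero false + g zero true) * ΣS n P
  ≡⟨ cong ((g zero false + g zero true) *_) (ΣS-∏ n (g ∘ suc)) ⟩
    prodF (suc n) (λ i → g i false + g i true)
  ∎
  where
  P : Subset n → ℤ
  P W = prodF n (λ i → g (suc i) (lookup W i))

sgn : ℕ → ℤ
sgn k = (- (+ 1)) ^ k

sgnB : Bool → ℤ
sgnB true  = - (+ 1)
sgnB false = + 1

sgn-+ : ∀ m k → sgn (m ℕ.+ k) ≡ sgn m * sgn k
sgn-+ = ^-distribˡ-+-* (- (+ 1))

sgn-sq : ∀ k → sgn k * sgn k ≡ + 1
sgn-sq zero    = refl
sgn-sq (suc k) = trans (square-neg (sgn k)) (sgn-sq k)
  where
  square-neg : ∀ a → - (+ 1) * a * (- (+ 1) * a) ≡ a * a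
  square-neg = solve-∀

sgn-∏ : ∀ n (W : Subset n) → sgn ∣ W ∣ ≡ prodF n (λ i → sgnB (lookup W i))
sgn-∏ zero    []          = refl
sgn-∏ (suc n) (true  ∷ W) = cong (- (+ 1) *_) (sgn-∏ n W)
sgn-∏ (suc n) (false ∷ W) = trans (sym (*-identityˡ _)) (cong (+ 1 *_) (sgn-∏ n W))

_⊆ᵇ_ : ∀ {n} → Subset n → (Fin n → Bool) → Bool
_⊆ᵇ_ {n} I P = allF n (λ i → not (lookup I i) ∨ P i)

choose-count : ∀ n (P : Fin n → Bool) j →
               ΣS n (λ I → ⟦ ∣ I ∣ ≡ᵇ j ⟧ * ⟦ I ⊆ᵇ P ⟧) ≡ + (countF n P C j)
choose-count zero    P zero    = refl
choose-count zero    P (suc j) = refl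
choose-count (suc n) P j       = trans (ΣS-suc n (λ I → ⟦ ∣ I ∣ ≡ᵇ j ⟧ * ⟦ I ⊆ᵇ P ⟧)) (split j (P zero))
  where
  c = countF n (P ∘ suc)
  count : ∀ j → ΣS n (λ I → ⟦ ∣ I ∣ ≡ᵇ j ⟧ * ⟦ I ⊆ᵇ (P ∘ suc) ⟧) ≡ + (c C j)
  count = choose-count n (P ∘ suc)
  -- subsets I with 0 ∉ I, plus subsets with 0 ∈ I (these need b = P 0 to hold)
  split : ∀ j b → ΣS n (λ I → ⟦ ∣ I ∣ ≡ᵇ j ⟧ * ⟦ I ⊆ᵇ (P ∘ suc) ⟧)
                  + ΣS n (λ I → ⟦ suc ∣ I ∣ ≡ᵇ j ⟧ * ⟦ b ∧ I ⊆ᵇ (P ∘ suc) ⟧)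
                  ≡ + ((if b then suc c else c) C j)
  split zero b = trans (cong₂ _+_ (count zero) (sum-zero (allSubsets n) (λ I → *-zeroˡ ⟦ b ∧ I ⊆ᵇ (P ∘ suc) ⟧)))
                       (choose-zero b)
    where
    choose-zero : ∀ b → + (c C 0) + + 0 ≡ + ((if b then suc c else c) C 0)
    choose-zero true  = refl
    choose-zero false = refl
  split (suc j) true  = trans (cong₂ _+_ (count (suc j)) (count j))
    (cong +_ (trans (ℕP.+-comm (c C suc j) (c C j)) (nCk+nC[k+1]≡[n+1]C[k+1] c j)))
  split (suc j) false = trans (cong (_+ ΣS n (λ I → ⟦ ∣ I ∣ ≡ᵇ j ⟧ * ⟦ false ⟧)) (count (suc j)))
    (trans (cong (_+_ (+ (c C suc j))) (sum-zero (allSubsets n) (λ I → *-zeroʳ ⟦ ∣ I ∣ ≡ᵇ j ⟧))) (+-identityʳ _))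

<ᵇ-suc : ∀ k j → (k <ᵇ suc j) ≡ (k ≤ᵇ j)
<ᵇ-suc zero    j = refl
<ᵇ-suc (suc k) j = refl

≤ᵇ-antisym : ∀ k j → (k ≤ᵇ j) ∧ (j ≤ᵇ k) ≡ (k ≡ᵇ j)
≤ᵇ-antisym zero    zero    = refl
≤ᵇ-antisym zero    (suc j) = refl
≤ᵇ-antisym (suc k) zero    = refl
≤ᵇ-antisym (suc k) (suc j) = trans (cong₂ _∧_ (<ᵇ-suc k j) (<ᵇ-suc j k)) (≤ᵇ-antisym k j)

monomial-δ : ∀ c k j → monomial c k j ≡ ⟦ k ≡ᵇ j ⟧ * c
monomial-δ c k j rewrite ≤ᵇ-antisym k j with k ≡ᵇ j
... | true  = sym (*-identityˡ c)
... | false = refl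

δ-subst : ∀ k j (f : ℕ → ℤ) → ⟦ k ≡ᵇ j ⟧ * f k ≡ ⟦ k ≡ᵇ j ⟧ * f j
δ-subst k j f with k ≡ᵇ j in eq
... | true  = cong (λ i → + 1 * f i) (ℕP.≡ᵇ⇒≡ k j (Equivalence.from T-≡ eq))
... | false = refl

monomial-on : ∀ c k → monomial c k k ≡ c
monomial-on c k = trans (monomial-δ c k k)
  (trans (cong (λ b → ⟦ b ⟧ * c) (Equivalence.to T-≡ (ℕP.≡⇒≡ᵇ k k refl))) (*-identityˡ c))

monomial-off : ∀ c k j → k ≢ j → monomial c k j ≡ + 0
monomial-off c k j k≢j with k ≡ᵇ j in eq | monomial-δ c k j
... | true  | _      = ⊥-elim (k≢j (ℕP.≡ᵇ⇒≡ k j (Equivalence.from T-≡ eq)))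
... | false | m≡0*c = m≡0*c

coefficient-above : ∀ m (c : ℕ → ℤ) j → m < j → sumP m (λ k → monomial (c k) k) j ≡ + 0
coefficient-above zero    c j m<j = monomial-off (c 0) 0 j (λ 0≡j → ℕP.<-irrefl 0≡j m<j)
coefficient-above (suc m) c j m<j =
  cong₂ _+_ (coefficient-above m c j (ℕP.<-trans (ℕP.n<1+n m) m<j))
            (monomial-off (c (suc m)) (suc m) j (λ m≡j → ℕP.<-irrefl m≡j m<j))

coefficient-within : ∀ m (c : ℕ → ℤ) j → j ≤ m → sumP m (λ k → monomial (c k) k) j ≡ c j
coefficient-within zero    c zero    _   = monomial-on (c 0) 0
coefficient-within (suc m) c j       j≤m with ℕP.m≤n⇒m<n∨m≡n j≤m
... | inj₁ j<m  = trans (cong₂ _+_ (coefficient-within m c j (ℕP.≤-pred j<m))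
                                   (monomial-off (c (suc m)) (suc m) j (λ m≡j → ℕP.<-irrefl (sym m≡j) j<m)))
                        (+-identityʳ (c j))
... | inj₂ refl = trans (cong₂ _+_ (coefficient-above m c (suc m) (ℕP.n<1+n m))
                                   (monomial-on (c (suc m)) (suc m)))
                        (+-identityˡ (c (suc m)))

coefficient : ∀ m (c : ℕ → ℤ) → (∀ j → m < j → c j ≡ + 0) →
              ∀ j → sumP m (λ k → monomial (c k) k) j ≡ c j
coefficient m c vanish j with ℕP.≤-<-connex j m
... | inj₁ j≤m = coefficient-within m c j j≤m
... | inj₂ m<j = trans (coefficient-above m c j m<j) (sym (vanish j m<j))

-- The guard in innerSum is redundant, since C(m, k) = 0 for k > m.
drop-guard : ∀ k m (s : ℤ) → (if k ≤ᵇ m then s * + (m C k) else + 0) ≡ s * + (m C k)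
drop-guard k m s = redundant (k ≤ᵇ m) refl
  where
  redundant : ∀ b → b ≡ (k ≤ᵇ m) → (if b then s * + (m C k) else + 0) ≡ s * + (m C k)
  redundant true  _  = refl
  redundant false eq = sym (trans (cong (λ x → s * + x) (k>n⇒nCk≡0 (ℕP.≰⇒> k≰m))) (*-zeroʳ s))
    where
    k≰m : ¬ k ≤ m
    k≰m k≤m = subst T (sym eq) (ℕP.≤⇒≤ᵇ k≤m)

-- Local form of the two graph conditions at a vertex u, for i = [u ∈ I],
-- a = [u has a neighbour in I] and b = [u ∈ W].  I ⊆ Iso(W) requires at u that
-- u ∈ I forces u ∈ W and that u ∈ W forbids a neighbour in I:
admissible : Bool → Bool → Bool → Bool
admissible i a b = (not i ∨ b) ∧ (not b ∨ not a)

-- and I is independent dominating iff at every u: u ∈ I has no neighbour in I,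
-- while u ∉ I has one.
ids-local : Bool → Bool → Bool
ids-local i a = (not i ∨ not a) ∧ (i ∨ a)

-- The one-vertex case of (*): summing over the bit b of W at u.
local-sum : ∀ i a → sgnB false * ⟦ admissible i a false ⟧ + sgnB true * ⟦ admissible i a true ⟧
                    ≡ sgnB i * ⟦ ids-local i a ⟧
local-sum true  true  = refl
local-sum true  false = refl
local-sum false true  = refl
local-sum false false = refl

not-∨-exchange : ∀ a b c → not a ∨ not (b ∧ c) ≡ not b ∨ not (a ∧ c)
not-∨-exchange true  true  c = refl
not-∨-exchange true  false c = refl
not-∨-exchange false true  c = refl
not-∨-exchange false false c = refl

module _ {n : ℕ} (G : Graph n) where

  hasNeighbourIn : Subset n → Fin n → Bool
  hasNeighbourIn S u = anyF n (λ v → lookup S v ∧ adj G u v)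

  isolatedIn : Subset n → Fin n → Bool
  isolatedIn W v = lookup W v ∧ not (hasNeighbourIn W v)

  neighbour-form : ∀ S v → any (λ u → u ∈ᵇ S ∧ adj G u v) (allFin n) ≡ hasNeighbourIn S v
  neighbour-form S v = trans (any-tabulate n _ id)
                             (anyF-cong n (λ u → cong (lookup S u ∧_) (symm G u v)))

  iso-form : ∀ W → iso G W ≡ countF n (isolatedIn W)
  iso-form W = trans (count-tabulate n _ id)
    (countF-cong n (λ v → cong (λ b → lookup W v ∧ not b) (neighbour-form W v)))

  ⊆-isolated-local : ∀ I W →
    I ⊆ᵇ isolatedIn W ≡ allF n (λ u → admissible (lookup I u) (hasNeighbourIn I u) (lookup W u))
  ⊆-isolated-local I W = begin
      allF n (λ v → not (I∋ v) ∨ (W∋ v ∧ not (hasNeighbourIn W v)))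
    ≡⟨ allF-cong n (λ v → ∨-distribˡ-∧ (not (I∋ v)) (W∋ v) _) ⟩
      allF n (λ v → (not (I∋ v) ∨ W∋ v) ∧ (not (I∋ v) ∨ not (hasNeighbourIn W v)))
    ≡⟨ allF-∧ n _ _ ⟩
      I⊆W ∧ allF n (λ v → not (I∋ v) ∨ not (hasNeighbourIn W v))
    ≡⟨ cong (I⊆W ∧_) (allF-cong n (λ v → ∨-not-anyF n (not (I∋ v)) _)) ⟩
      I⊆W ∧ allF n (λ v → allF n (λ u → not (I∋ v) ∨ not (W∋ u ∧ adj G v u)))
    ≡⟨ cong (I⊆W ∧_) (allF-swap n n _) ⟩
      I⊆W ∧ allF n (λ u → allF n (λ v → not (I∋ v) ∨ not (W∋ u ∧ adj G v u)))
    ≡⟨ cong (I⊆W ∧_) (allF-cong n (λ u → allF-cong n (λ v → exchange u v))) ⟩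
      I⊆W ∧ allF n (λ u → allF n (λ v → not (W∋ u) ∨ not (I∋ v ∧ adj G u v)))
    ≡⟨ cong (I⊆W ∧_) (allF-cong n (λ u → sym (∨-not-anyF n (not (W∋ u)) _))) ⟩
      I⊆W ∧ allF n (λ u → not (W∋ u) ∨ not (hasNeighbourIn I u))
    ≡⟨ sym (allF-∧ n _ _) ⟩
      allF n (λ u → admissible (I∋ u) (hasNeighbourIn I u) (W∋ u))
    ∎
    where
    I∋ W∋ : Fin n → Bool
    I∋ = lookup I
    W∋ = lookup W
    I⊆W = allF n (λ v → not (I∋ v) ∨ W∋ v)
    exchange : ∀ u v → not (I∋ v) ∨ not (W∋ u ∧ adj G v u) ≡ not (W∋ u) ∨ not (I∋ v ∧ adj G u v)
    exchange u v = trans (cong (λ e → not (I∋ v) ∨ not (W∋ u ∧ e)) (symm G v u))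
                         (not-∨-exchange (I∋ v) (W∋ u) (adj G u v))

  ids-local-form : ∀ I →
    isIndepDominating G I ≡ allF n (λ u → ids-local (lookup I u) (hasNeighbourIn I u))
  ids-local-form I = trans (cong₂ _∧_ independent dominating) (sym (allF-∧ n _ _))
    where
    independent : isIndependent G I ≡ allF n (λ u → not (lookup I u) ∨ not (hasNeighbourIn I u))
    independent = begin
        all (λ u → all (λ v → not (lookup I u ∧ lookup I v ∧ adj G u v)) (allFin n)) (allFin n)
      ≡⟨ all-tabulate n _ id ⟩
        allF n (λ u → all (λ v → not (lookup I u ∧ lookup I v ∧ adj G u v)) (allFin n))
      ≡⟨ allF-cong n (λ u → all-tabulate n _ id) ⟩
        allF n (λ u → allF n (λ v → not (lookup I u ∧ (lookup I v ∧ adj G u v))))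
      ≡⟨ allF-cong n (λ u → allF-cong n (λ v → deMorgan₁ (lookup I u) _)) ⟩
        allF n (λ u → allF n (λ v → not (lookup I u) ∨ not (lookup I v ∧ adj G u v)))
      ≡⟨ allF-cong n (λ u → sym (∨-not-anyF n (not (lookup I u)) _)) ⟩
        allF n (λ u → not (lookup I u) ∨ not (hasNeighbourIn I u))
      ∎
    dominating : isDominating G I ≡ allF n (λ v → lookup I v ∨ hasNeighbourIn I v)
    dominating = trans (all-tabulate n _ id)
                       (allF-cong n (λ v → cong (lookup I v ∨_) (neighbour-form I v)))

  inclusion-exclusion : ∀ I → ΣS n (λ W → sgn ∣ W ∣ * ⟦ I ⊆ᵇ isolatedIn W ⟧)
                              ≡ sgn ∣ I ∣ * ⟦ isIndepDominating G I ⟧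
  inclusion-exclusion I = begin
      ΣS n (λ W → sgn ∣ W ∣ * ⟦ I ⊆ᵇ isolatedIn W ⟧)
    ≡⟨ sum-cong (allSubsets n) factor ⟩
      ΣS n (λ W → prodF n (λ u → g u (lookup W u)))
    ≡⟨ ΣS-∏ n g ⟩
      prodF n (λ u → g u false + g u true)
    ≡⟨ prodF-cong n (λ u → local-sum (lookup I u) (hasNeighbourIn I u)) ⟩
      prodF n (λ u → sgnB (lookup I u) * ⟦ ok u ⟧)
    ≡⟨ sym (prodF-* n _ _) ⟩
      prodF n (λ u → sgnB (lookup I u)) * prodF n (λ u → ⟦ ok u ⟧)
    ≡⟨ cong₂ _*_ (sym (sgn-∏ n I)) (sym (⟦allF⟧ n ok)) ⟩
      sgn ∣ I ∣ * ⟦ allF n ok ⟧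
    ≡⟨ cong (λ b → sgn ∣ I ∣ * ⟦ b ⟧) (sym (ids-local-form I)) ⟩
      sgn ∣ I ∣ * ⟦ isIndepDominating G I ⟧
    ∎
    where
    ok : Fin n → Bool
    ok u = ids-local (lookup I u) (hasNeighbourIn I u)
    g : Fin n → Bool → ℤ
    g u b = sgnB b * ⟦ admissible (lookup I u) (hasNeighbourIn I u) b ⟧
    factor : ∀ W → sgn ∣ W ∣ * ⟦ I ⊆ᵇ isolatedIn W ⟧ ≡ prodF n (λ u → g u (lookup W u))
    factor W = trans (cong₂ _*_ (sgn-∏ n W) (trans (cong ⟦_⟧ (⊆-isolated-local I W)) (⟦allF⟧ n _)))
                     (prodF-* n _ _)

  ids-indicator : ∀ I → ⟦ isIndepDominating G I ⟧
                        ≡ sgn ∣ I ∣ * ΣS n (λ W → sgn ∣ W ∣ * ⟦ I ⊆ᵇ isolatedIn W ⟧)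
  ids-indicator I = begin
      ⟦ isIndepDominating G I ⟧
    ≡⟨ sym (*-identityˡ _) ⟩
      + 1 * ⟦ isIndepDominating G I ⟧
    ≡⟨ cong (_* ⟦ isIndepDominating G I ⟧) (sym (sgn-sq ∣ I ∣)) ⟩
      sgn ∣ I ∣ * sgn ∣ I ∣ * ⟦ isIndepDominating G I ⟧
    ≡⟨ *-assoc (sgn ∣ I ∣) _ _ ⟩
      sgn ∣ I ∣ * (sgn ∣ I ∣ * ⟦ isIndepDominating G I ⟧)
    ≡⟨ cong (sgn ∣ I ∣ *_) (sym (inclusion-exclusion I)) ⟩
      sgn ∣ I ∣ * ΣS n (λ W → sgn ∣ W ∣ * ⟦ I ⊆ᵇ isolatedIn W ⟧)
    ∎

  ID-coefficient : ∀ j → ID G j ≡ ΣS n (λ I → ⟦ ∣ I ∣ ≡ᵇ j ⟧ * ⟦ isIndepDominating G I ⟧)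
  ID-coefficient j = go (allSubsets n)
    where
    add : ∀ k b (p : Poly) →
          (if b then monomial (+ 1) k ⊕ p else p) j ≡ ⟦ k ≡ᵇ j ⟧ * ⟦ b ⟧ + p j
    add k true  p = cong (_+ p j) (monomial-δ (+ 1) k j)
    add k false p = sym (trans (cong (_+ p j) (*-zeroʳ ⟦ k ≡ᵇ j ⟧)) (+-identityˡ (p j)))
    go : ∀ L → foldr (λ W p → if isIndepDominating G W then monomial (+ 1) ∣ W ∣ ⊕ p else p)
                     zeroP L j
               ≡ sumℤ (map (λ I → ⟦ ∣ I ∣ ≡ᵇ j ⟧ * ⟦ isIndepDominating G I ⟧) L)
    go []      = refl
    go (W ∷ L) = trans (add ∣ W ∣ (isIndepDominating G W) _) (cong (_+_ (⟦ ∣ W ∣ ≡ᵇ j ⟧ * ⟦ isIndepDominating G W ⟧)) (go L))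

  ID-coefficient-binomial : ∀ j → ID G j ≡ ΣS n (λ W → sgn (∣ W ∣ ℕ.+ j) * + (iso G W C j))
  ID-coefficient-binomial j = begin
      ID G j
    ≡⟨ ID-coefficient j ⟩
      ΣS n (λ I → ⟦ ∣ I ∣ ≡ᵇ j ⟧ * ⟦ isIndepDominating G I ⟧)
    ≡⟨ sum-cong (allSubsets n) expand ⟩
      ΣS n (λ I → ΣS n (λ W → term W I))
    ≡⟨ sym (sum-swap (allSubsets n) (allSubsets n) term) ⟩
      ΣS n (λ W → ΣS n (λ I → term W I))
    ≡⟨ sum-cong (allSubsets n) (λ W → sum-* (allSubsets n) (sgn (∣ W ∣ ℕ.+ j)) _) ⟩
      ΣS n (λ W → sgn (∣ W ∣ ℕ.+ j) * ΣS n (λ I → ⟦ ∣ I ∣ ≡ᵇ j ⟧ * ⟦ I ⊆ᵇ isolatedIn W ⟧))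
    ≡⟨ sum-cong (allSubsets n) (λ W → cong (sgn (∣ W ∣ ℕ.+ j) *_) (subsets-of-Iso W)) ⟩
      ΣS n (λ W → sgn (∣ W ∣ ℕ.+ j) * + (iso G W C j))
    ∎
    where
    term : Subset n → Subset n → ℤ
    term W I = sgn (∣ W ∣ ℕ.+ j) * (⟦ ∣ I ∣ ≡ᵇ j ⟧ * ⟦ I ⊆ᵇ isolatedIn W ⟧)
    subsets-of-Iso : ∀ W → ΣS n (λ I → ⟦ ∣ I ∣ ≡ᵇ j ⟧ * ⟦ I ⊆ᵇ isolatedIn W ⟧) ≡ + (iso G W C j)
    subsets-of-Iso W = trans (choose-count n (isolatedIn W) j)
                             (cong (λ m → + (m C j)) (sym (iso-form W)))
    -- (*) substituted for each I, with (-1)^|I| = (-1)^j under the delta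
    expand : ∀ I → ⟦ ∣ I ∣ ≡ᵇ j ⟧ * ⟦ isIndepDominating G I ⟧ ≡ ΣS n (λ W → term W I)
    expand I = begin
        δ * ⟦ isIndepDominating G I ⟧
      ≡⟨ cong (δ *_) (ids-indicator I) ⟩
        δ * (sgn ∣ I ∣ * S)
      ≡⟨ δ-subst ∣ I ∣ j (λ k → sgn k * S) ⟩
        δ * (sgn j * S)
      ≡⟨ sym (*-assoc δ (sgn j) S) ⟩
        δ * sgn j * S
      ≡⟨ sym (sum-* (allSubsets n) (δ * sgn j) _) ⟩
        ΣS n (λ W → δ * sgn j * (sgn ∣ W ∣ * ⟦ I ⊆ᵇ isolatedIn W ⟧))
      ≡⟨ sum-cong (allSubsets n) regroup ⟩
        ΣS n (λ W → term W I)
      ∎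
      where
      δ = ⟦ ∣ I ∣ ≡ᵇ j ⟧
      S = ΣS n (λ W → sgn ∣ W ∣ * ⟦ I ⊆ᵇ isolatedIn W ⟧)
      rearrange : ∀ d s t x → d * s * (t * x) ≡ t * s * (d * x)
      rearrange = solve-∀
      regroup : ∀ W → δ * sgn j * (sgn ∣ W ∣ * ⟦ I ⊆ᵇ isolatedIn W ⟧) ≡ term W I
      regroup W = trans (rearrange δ (sgn j) (sgn ∣ W ∣) _)
                        (cong (_* (δ * ⟦ I ⊆ᵇ isolatedIn W ⟧)) (sym (sgn-+ ∣ W ∣ j)))

  innerSum-binomial : ∀ j → innerSum G j ≡ ΣS n (λ W → sgn (∣ W ∣ ℕ.+ j) * + (iso G W C j))
  innerSum-binomial j = sum-cong (allSubsets n) (λ W → drop-guard j (iso G W) (sgn (∣ W ∣ ℕ.+ j)))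

  -- The inner sums vanish above degree n, since iso(G[W]) ≤ n.
  innerSum-vanishes : ∀ j → n < j → innerSum G j ≡ + 0
  innerSum-vanishes j n<j = trans (innerSum-binomial j) (sum-zero (allSubsets n) vanish)
    where
    vanish : ∀ W → sgn (∣ W ∣ ℕ.+ j) * + (iso G W C j) ≡ + 0
    vanish W = trans (cong (λ x → sgn (∣ W ∣ ℕ.+ j) * + x) (k>n⇒nCk≡0 iso<j)) (*-zeroʳ (sgn (∣ W ∣ ℕ.+ j)))
      where
      iso<j : iso G W < j
      iso<j = ℕP.≤-<-trans (subst (_≤ n) (sym (iso-form W)) (countF≤ n (isolatedIn W))) n<j

mainTheorem9 : (n : ℕ) (G : Graph n) (j : ℕ) →
    ID G j ≡ sumP n (λ k → monomial (innerSum G k) k) j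
mainTheorem9 n G j = begin
    ID G j
  ≡⟨ ID-coefficient-binomial G j ⟩
    ΣS n (λ W → sgn (∣ W ∣ ℕ.+ j) * + (iso G W C j))
  ≡⟨ sym (innerSum-binomial G j) ⟩
    innerSum G j
  ≡⟨ sym (coefficient n (innerSum G) (innerSum-vanishes G) j) ⟩
    sumP n (λ k → monomial (innerSum G k) k) j
  ∎
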